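{- Let $G\colon\mathsf{Pos}\to\mathsf{Pos}$ be a functor, $(\alpha,\mathbb{M})$ a graded behavioural preorder on $G$-coalgebras with $\mathbb{M}$ a depth-1 graded monad, and $\mathcal{L}$ a graded logic for it. Let $x,y$ be states in $G$-coalgebras $(X,\gamma)$ and $(Y,\delta)$, respectively. If $y$ $(\alpha,\mathbb{M})$-refines $x$, then $[\![\varphi]\!]_\gamma(x)\le[\![\varphi]\!]_\delta(y)$ for every formula $\varphi$.
   Context: $\mathsf{Pos}$ is the category of posets and monotone maps; $1$ the one-element poset, $!\colon X\to 1$. Standing assumption: $G$ is finitary, locally monotone, and preserves epimorphisms and regular monomorphisms. A graded monad $\mathbb{M}$ on $\mathsf{Pos}$: functors $M_n$ ($n<\omega$), natural $\eta\colon\mathrm{Id}\to M_0$, natural $\mu^{n,k}\colon M_nM_k\to M_{n+k}$ with $\mu^{n,0}\cdot M_n\eta=\mathrm{id}=\mu^{0,n}\cdot\eta M_n$ and $\mu^{n,k+m}\cdot M_n\mu^{k,m}=\mu^{n+k,m}\cdot\mu^{n,k}M_m$. $M_0$-algebras are Eilenberg–Moore algebras of the monad $(M_0,\eta,\mu^{0,0})$; $M_nX$ is an $M_0$-algebra via $\mu^{0,n}_X$. An $M_1$-algebra: posets $A_0,A_1$, monotone $a^{00}\colon M_0A_0\to A_0$, $a^{01}\colon M_0A_1\to A_1$, $a^{10}\colon M_1A_0\to A_1$, with $(A_0,a^{00}),(A_1,a^{01})$ $M_0$-algebras, $a^{10}\cdot\mu^{0,1}_{A_0}=a^{01}\cdot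 M_0a^{10}$, $a^{10}\cdot\mu^{1,0}_{A_0}=a^{10}\cdot M_1a^{00}$. Morphisms $(h_0,h_1)$: monotone, commuting with $a^{00},a^{01},a^{10}$ in the evident way ($b^{10}\cdot M_1h_0=h_1\cdot a^{10}$ etc.). Canonical: for every $M_1$-algebra $B$ and $M_0$-morphism $h\colon A_0\to B_0$ there is a unique monotone $h^\sharp\colon A_1\to B_1$ making $(h,h^\sharp)$ a morphism. $\mathbb{M}$ is depth-1 if it is isomorphic to the graded monad induced by a graded inequational theory all of whose operations and axioms have depth $\le 1$ (the induced graded monad has $M_nX$ the $n$-th carrier of the free model of the theory on $X$, unit the universal map, and multiplication induced by the universal property of free models); for depth-1 $\mathbb{M}$, each $M_1$-algebra with carriers $M_n1,M_{n+1}1$ and structure $\mu^{0,n}_1,\mu^{0,n+1}_1,\mu^{1,n}_1$ is canonical. A graded behavioural preorder is $(\alpha,\mathbb{M})$ with $\alpha\colon G\to M_1$ natural; for a $G$-coalgebra $\gamma\colon X\to GX$: $\gamma^{(0)}=\eta_X$, $\gamma^{(n+1)}=\mu^{1,n}_X\cdot M_1\gamma^{(n)}\cdot\alpha_X\cdot\gamma$; $y$ $(\alpha,\mathbb{M})$-refines $x$ if $M_n!\cdot\gamma^{(n)}(x)\le M_n!\cdot\delta^{(n)}(y)$ for all $n$. Graded logic: truth constants $\Theta$, propositional operators $\mathcal{O}$ with finite arities (0-ary ones also truth constants), unary modalities $\Lambda$; $\mathcal{L}_0$: $\varphi::=p(\varphi_1,\dots,\varphi_k)\mid c$; $\mathcal{L}_{n+1}$: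 $\varphi::=p(\varphi_1,\dots,\varphi_k)\mid L(\psi)$, $\psi\in\mathcal{L}_n$. Semantics data: $M_0$-algebra $(\Omega,o)$; $\hat c\colon1\to\Omega$; $M_0$-morphisms $[\![p]\!]\colon\Omega^k\to\Omega$; for each $L$ an $M_1$-algebra with carriers $\Omega,\Omega$, structure $o,o,[\![L]\!]\colon M_1\Omega\to\Omega$. For canonical $A$ and $M_0$-morphism $f\colon A_0\to\Omega$, $[\![L]\!](f)$ is the unique map with $(f,[\![L]\!](f))$ an $M_1$-morphism into that algebra. $[\![c]\!]=o\cdot M_0\hat c$, $[\![p(\varphi_i)]\!]=[\![p]\!]\cdot\langle[\![\varphi_i]\!]\rangle$, $[\![L(\varphi)]\!]=[\![L]\!]([\![\varphi]\!])$, as maps $M_n1\to\Omega$ for $\varphi\in\mathcal{L}_n$; $[\![\varphi]\!]_\gamma=[\![\varphi]\!]\cdot M_n!\cdot\gamma^{(n)}$. -}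

module Defs where

open import Level using (0ℓ)
open import Data.Nat using (ℕ; zero; suc; _+_)
open import Data.Nat.Properties using (+-identityʳ; +-assoc)
open import Data.Fin using (Fin)
open import Data.Unit using (⊤; tt)
open import Data.Product using (Σ; _,_; proj₁; proj₂; _×_)
open import Relation.Binary.Bundles using (Poset)
open import Relation.Binary.Structures using (IsPartialOrder; IsPreorder; IsEquivalence)
open import Relation.Binary.PropositionalEquality using (_≡_; refl)
import Relation.Binary.Reasoning.Setoid as SetoidR

Pos : Set₁
Pos = Poset 0ℓ 0ℓ 0ℓ

open Poset using (Carrier) public

record Mono (P Q : Pos) : Set where
  field
    fun  : Carrier P → Carrier Q
    cong : ∀ {x y} → Poset._≈_ P x y → Poset._≈_ Q (fun x) (fun y)
    mono : ∀ {x y} → Poset._≤_ P x y → Poset._≤_ Q (fun x) (fun y)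
open Mono public

_≐_ : {P Q : Pos} → Mono P Q → Mono P Q → Set
_≐_ {P} {Q} f g = ∀ x → Poset._≈_ Q (fun f x) (fun g x)

_≤M_ : {P Q : Pos} → Mono P Q → Mono P Q → Set
_≤M_ {P} {Q} f g = ∀ x → Poset._≤_ Q (fun f x) (fun g x)

idM : {P : Pos} → Mono P P
idM = record { fun = λ x → x ; cong = λ p → p ; mono = λ p → p }

infixr 9 _∘M_
_∘M_ : {P Q R : Pos} → Mono Q R → Mono P Q → Mono P R
g ∘M f = record { fun = λ x → fun g (fun f x)
                ; cong = λ p → cong g (cong f p)
                ; mono = λ p → mono g (mono f p) }

One : Pos
One = record
  { Carrier = ⊤ ; _≈_ = λ _ _ → ⊤ ; _≤_ = λ _ _ → ⊤
  ; isPartialOrder = record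
      { isPreorder = record
          { isEquivalence = record { refl = tt ; sym = λ _ → tt ; trans = λ _ _ → tt }
          ; reflexive = λ _ → tt ; trans = λ _ _ → tt }
      ; antisym = λ _ _ → tt } }

! : {X : Pos} → Mono X One
! = record { fun = λ _ → tt ; cong = λ _ → tt ; mono = λ _ → tt }

Pow : Pos → ℕ → Pos
Pow Ω k = record
  { Carrier = Fin k → Carrier Ω
  ; _≈_ = λ u v → ∀ i → Poset._≈_ Ω (u i) (v i)
  ; _≤_ = λ u v → ∀ i → Poset._≤_ Ω (u i) (v i)
  ; isPartialOrder = record
      { isPreorder = record
          { isEquivalence = record
              { refl = λ i → Poset.Eq.refl Ω
              ; sym = λ p i → Poset.Eq.sym Ω (p i)
              ; trans = λ p q i → Poset.Eq.trans Ω (p i) (q i) }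
          ; reflexive = λ p i → Poset.reflexive Ω (p i)
          ; trans = λ p q i → Poset.trans Ω (p i) (q i) }
      ; antisym = λ p q i → Poset.antisym Ω (p i) (q i) } }

proj : {Ω : Pos} {k : ℕ} → Fin k → Mono (Pow Ω k) Ω
proj i = record { fun = λ u → u i ; cong = λ p → p i ; mono = λ p → p i }

tuple : {P Ω : Pos} {k : ℕ} → (Fin k → Mono P Ω) → Mono P (Pow Ω k)
tuple fs = record { fun = λ x i → fun (fs i) x
                  ; cong = λ p i → cong (fs i) p
                  ; mono = λ p i → mono (fs i) p }

record Functor : Set₁ where
  field
    obj      : Pos → Pos
    map      : ∀ {P Q} → Mono P Q → Mono (obj P) (obj Q)
    map-cong : ∀ {P Q} {f g : Mono P Q} → f ≐ g → map f ≐ map g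
    map-id   : ∀ {P} → map (idM {P}) ≐ idM
    map-∘    : ∀ {P Q R} (g : Mono Q R) (f : Mono P Q) → map (g ∘M f) ≐ (map g ∘M map f)
open Functor public

record NatTrans (F H : Functor) : Set₁ where
  field
    comp : ∀ X → Mono (obj F X) (obj H X)
    nat  : ∀ {X Y} (f : Mono X Y) → (comp Y ∘M map F f) ≐ (map H f ∘M comp X)
open NatTrans public

IsEpi : {P Q : Pos} → Mono P Q → Set₁
IsEpi {P} {Q} e = ∀ (R : Pos) (g h : Mono Q R) → (g ∘M e) ≐ (h ∘M e) → g ≐ h

IsRegularMono : {P Q : Pos} → Mono P Q → Set₁
IsRegularMono {P} {Q} m =
  Σ Pos λ R → Σ (Mono Q R) λ g → Σ (Mono Q R) λ h →
    ((g ∘M m) ≐ (h ∘M m)) ×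
    (∀ (S : Pos) (k : Mono S Q) → (g ∘M k) ≐ (h ∘M k) →
       Σ (Mono S P) λ u → ((m ∘M u) ≐ k) × (∀ (u' : Mono S P) → (m ∘M u') ≐ k → u' ≐ u))

-- standing assumptions on G (finitariness omitted)
record StandingAssumptions (G : Functor) : Set₁ where
  field
    locallyMonotone : ∀ {P Q} {f g : Mono P Q} → f ≤M g → map G f ≤M map G g
    preservesEpi    : ∀ {P Q} (e : Mono P Q) → IsEpi e → IsEpi (map G e)
    preservesRegMono : ∀ {P Q} (m : Mono P Q) → IsRegularMono m → IsRegularMono (map G m)

castM : (F : ℕ → Functor) {n m : ℕ} → n ≡ m → (X : Pos) → Mono (obj (F n) X) (obj (F m) X)
castM F refl X = idM

record GradedMonad : Set₁ where
  field
    M      : ℕ → Functor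
    η      : ∀ X → Mono X (obj (M 0) X)
    η-nat  : ∀ {X Y} (f : Mono X Y) → (η Y ∘M f) ≐ (map (M 0) f ∘M η X)
    μ      : ∀ n k X → Mono (obj (M n) (obj (M k) X)) (obj (M (n + k)) X)
    μ-nat  : ∀ n k {X Y} (f : Mono X Y) →
               (μ n k Y ∘M map (M n) (map (M k) f)) ≐ (map (M (n + k)) f ∘M μ n k X)
    unitˡ  : ∀ n X → (μ 0 n X ∘M η (obj (M n) X)) ≐ idM
    unitʳ  : ∀ n X → (castM M (+-identityʳ n) X ∘M (μ n 0 X ∘M map (M n) (η X))) ≐ idM
    assoc  : ∀ n k m X →
               (castM M (+-assoc n k m) X ∘M (μ (n + k) m X ∘M μ n k (obj (M m) X)))
                 ≐ (μ n (k + m) X ∘M map (M n) (μ k m X))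
open GradedMonad public

module _ (GM : GradedMonad) where

  M₀ M₁ : Pos → Pos
  M₀ = obj (M GM 0)
  M₁ = obj (M GM 1)

  record IsM0Alg {A : Pos} (a : Mono (M₀ A) A) : Set where
    field
      alg-unit  : (a ∘M η GM A) ≐ idM
      alg-assoc : (a ∘M μ GM 0 0 A) ≐ (a ∘M map (M GM 0) a)

  IsM0Hom : {A B : Pos} → Mono (M₀ A) A → Mono (M₀ B) B → Mono A B → Set
  IsM0Hom a b h = (h ∘M a) ≐ (b ∘M map (M GM 0) h)

  record M1Str : Set₁ where
    field
      A₀ A₁ : Pos
      a00 : Mono (M₀ A₀) A₀
      a01 : Mono (M₀ A₁) A₁
      a10 : Mono (M₁ A₀) A₁
  open M1Str public

  record IsM1Alg (A : M1Str) : Set where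
    field
      isAlg0 : IsM0Alg (a00 A)
      isAlg1 : IsM0Alg (a01 A)
      law01  : (a10 A ∘M μ GM 0 1 (A₀ A)) ≐ (a01 A ∘M map (M GM 0) (a10 A))
      law10  : (a10 A ∘M μ GM 1 0 (A₀ A)) ≐ (a10 A ∘M map (M GM 1) (a00 A))

  record M1Alg : Set₁ where
    field
      str   : M1Str
      isAlg : IsM1Alg str

  record IsM1Hom (A B : M1Str) (h₀ : Mono (A₀ A) (A₀ B)) (h₁ : Mono (A₁ A) (A₁ B)) : Set where
    field
      hom00 : (h₀ ∘M a00 A) ≐ (a00 B ∘M map (M GM 0) h₀)
      hom01 : (h₁ ∘M a01 A) ≐ (a01 B ∘M map (M GM 0) h₁)
      hom10 : (h₁ ∘M a10 A) ≐ (a10 B ∘M map (M GM 1) h₀)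

  Canonical : M1Str → Set₁
  Canonical A = ∀ (B : M1Alg) (h : Mono (A₀ A) (A₀ (M1Alg.str B))) →
    IsM0Hom (a00 A) (a00 (M1Alg.str B)) h →
    Σ (Mono (A₁ A) (A₁ (M1Alg.str B))) λ h♯ →
      IsM1Hom A (M1Alg.str B) h h♯ ×
      (∀ (h' : Mono (A₁ A) (A₁ (M1Alg.str B))) → IsM1Hom A (M1Alg.str B) h h' → h' ≐ h♯)

  AlgN : ℕ → M1Str
  AlgN n = record
    { A₀ = obj (M GM n) One ; A₁ = obj (M GM (suc n)) One
    ; a00 = μ GM 0 n One ; a01 = μ GM 0 (suc n) One ; a10 = μ GM 1 n One }

  -- the consequence of depth-1 used by the paper
  CanonicalAlgebras : Set₁
  CanonicalAlgebras = ∀ n → Canonical (AlgN n)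

  module _ {G : Functor} (α : NatTrans G (M GM 1)) where

    iter : ∀ {X : Pos} (γ : Mono X (obj G X)) n → Mono X (obj (M GM n) X)
    iter {X} γ zero    = η GM X
    iter {X} γ (suc n) = μ GM 1 n X ∘M map (M GM 1) (iter γ n) ∘M comp α X ∘M γ

    Refines : ∀ {X Y : Pos} (γ : Mono X (obj G X)) (δ : Mono Y (obj G Y)) →
              Carrier X → Carrier Y → Set
    Refines {X} {Y} γ δ x y = ∀ n →
      Poset._≤_ (obj (M GM n) One)
        (fun (map (M GM n) ! ∘M iter γ n) x)
        (fun (map (M GM n) ! ∘M iter δ n) y)

record LogicSig : Set₁ where
  field
    Θ   : Set
    Op  : Set
    ar  : Op → ℕ
    Λ   : Set
open LogicSig public

data Form (S : LogicSig) : ℕ → Set where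
  op    : ∀ {n} (p : Op S) → (Fin (ar S p) → Form S n) → Form S n
  const : Θ S → Form S 0
  mod   : ∀ {n} → Λ S → Form S n → Form S (suc n)

module _ (GM : GradedMonad) where

  powStr : {Ω : Pos} (o : Mono (M₀ GM Ω) Ω) (k : ℕ) → Mono (M₀ GM (Pow Ω k)) (Pow Ω k)
  powStr o k = tuple (λ i → o ∘M map (M GM 0) (proj i))

  record LogicSem (S : LogicSig) : Set₁ where
    field
      Ω     : Pos
      o     : Mono (M₀ GM Ω) Ω
      o-alg : IsM0Alg GM o
      ĉ     : Θ S → Mono One Ω
      ⟦_⟧op : ∀ p → Mono (Pow Ω (ar S p)) Ω
      opIsHom : ∀ p → IsM0Hom GM (powStr o (ar S p)) o ⟦ p ⟧op
      ⟦_⟧mod : Λ S → Mono (M₁ GM Ω) Ω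
      modAlgLaws : ∀ L → IsM1Alg GM (record { A₀ = Ω ; A₁ = Ω ; a00 = o ; a01 = o ; a10 = ⟦ L ⟧mod })

  module Semantics {S : LogicSig} (I : LogicSem S) (canon : CanonicalAlgebras GM) where
    open LogicSem I

    modAlg : Λ S → M1Alg GM
    modAlg L = record { str = record { A₀ = Ω ; A₁ = Ω ; a00 = o ; a01 = o ; a10 = ⟦ L ⟧mod }
                      ; isAlg = modAlgLaws L }

    private
      module ΩR = SetoidR (Poset.Eq.setoid Ω)
      M0c = map (M GM 0)

    constHom : ∀ c → IsM0Hom GM (μ GM 0 0 One) o (o ∘M M0c (ĉ c))
    constHom c x = begin
        fun o (fun (M0c (ĉ c)) (fun (μ GM 0 0 One) x))
          ≈⟨ cong o (Poset.Eq.sym (M₀ GM Ω) (μ-nat GM 0 0 (ĉ c) x)) ⟩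
        fun o (fun (μ GM 0 0 Ω) (fun (M0c (M0c (ĉ c))) x))
          ≈⟨ IsM0Alg.alg-assoc o-alg _ ⟩
        fun o (fun (M0c o) (fun (M0c (M0c (ĉ c))) x))
          ≈⟨ cong o (Poset.Eq.sym (M₀ GM Ω) (map-∘ (M GM 0) o (M0c (ĉ c)) x)) ⟩
        fun o (fun (M0c (o ∘M M0c (ĉ c))) x) ∎
      where open ΩR

    opHom : ∀ {n} p (fs : Fin (ar S p) → Mono (obj (M GM n) One) Ω) →
            (∀ i → IsM0Hom GM (μ GM 0 n One) o (fs i)) →
            IsM0Hom GM (μ GM 0 n One) o (⟦ p ⟧op ∘M tuple fs)
    opHom {n} p fs hs x = begin
        fun ⟦ p ⟧op (λ i → fun (fs i) (fun (μ GM 0 n One) x))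
          ≈⟨ cong ⟦ p ⟧op (λ i → Poset.Eq.trans Ω (hs i x)
                 (cong o (map-∘ (M GM 0) (proj i) (tuple fs) x))) ⟩
        fun ⟦ p ⟧op (fun (powStr o (ar S p)) (fun (M0c (tuple fs)) x))
          ≈⟨ opIsHom p _ ⟩
        fun o (fun (M0c ⟦ p ⟧op) (fun (M0c (tuple fs)) x))
          ≈⟨ cong o (Poset.Eq.sym (M₀ GM Ω) (map-∘ (M GM 0) ⟦ p ⟧op (tuple fs) x)) ⟩
        fun o (fun (M0c (⟦ p ⟧op ∘M tuple fs)) x) ∎
      where open ΩR

    sem : ∀ {n} → Form S n → Σ (Mono (obj (M GM n) One) Ω) (IsM0Hom GM (μ GM 0 n One) o)
    sem (op p φs) = ⟦ p ⟧op ∘M tuple (λ i → proj₁ (sem (φs i)))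
                  , opHom p _ (λ i → proj₂ (sem (φs i)))
    sem (const c) = o ∘M M0c (ĉ c) , constHom c
    sem {suc n} (mod L φ) =
      let r = canon n (modAlg L) (proj₁ (sem φ)) (proj₂ (sem φ))
      in proj₁ r , IsM1Hom.hom01 (proj₁ (proj₂ r))

    ⟦_⟧ : ∀ {n} → Form S n → Mono (obj (M GM n) One) Ω
    ⟦ φ ⟧ = proj₁ (sem φ)

    ⟦_⟧at : ∀ {n} → Form S n → {G : Functor} (α : NatTrans G (M GM 1))
            {X : Pos} (γ : Mono X (obj G X)) → Carrier X → Carrier Ω
    ⟦_⟧at {n} φ α γ x = fun (⟦ φ ⟧ ∘M map (M GM n) ! ∘M iter GM α γ n) x

module Submission where

open import Defs
open import Data.Nat using (ℕ)
open import Relation.Binary.Bundles using (Poset)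

mainTheorem2 : (G : Functor) → StandingAssumptions G →
               (GM : GradedMonad) → (α : NatTrans G (M GM 1)) →
               (depth1 : CanonicalAlgebras GM) →
               (S : LogicSig) (I : LogicSem GM S) →
               {X Y : Pos} (γ : Mono X (obj G X)) (δ : Mono Y (obj G Y)) →
               (x : Carrier X) (y : Carrier Y) →
               Refines GM α γ δ x y →
               ∀ {n : ℕ} (φ : Form S n) →
               Poset._≤_ (LogicSem.Ω I)
                 (Semantics.⟦_⟧at GM I depth1 φ α γ x)
                 (Semantics.⟦_⟧at GM I depth1 φ α δ y)
mainTheorem2 _ _ GM _ depth1 _ I _ _ _ _ refines {n} φ =
  mono (Semantics.⟦_⟧ GM I depth1 φ) (refines n)
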